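{- Let $R,S\in\mathfrak{P}$. Then $R\sqsubseteq S\Leftrightarrow R^d\sqsubseteq S^d$; $R\sqsubseteq_G S\Leftrightarrow R^d\sqsubseteq_G S^d$; $R\sqsubseteq_I S\Leftrightarrow R^d\sqsubseteq_I S^d$; and $R\sqsubseteq R^d\Leftrightarrow R\simeq R^d$.
   Context: $\mathfrak{P}$ is the class of finite nonempty posets and $\mathfrak{P}_r$ a fixed system of representatives of its isomorphism classes. $P^d$ is the dual poset. $\mathcal{H}(P,Q)$ is the set of order-preserving maps $P\to Q$. For $A\subseteq P$, $x\in A$: $\gamma_A(x)$ is the set of $y\in A$ joined to $x$ by a sequence $x=z_0,\dots,z_L=y$ in $A$ ($L\ge0$) with consecutive elements strictly comparable; for a map $\xi$ on $P$, $G_\xi(x):=\gamma_{\xi^{ -1}(\xi(x))}(x)$. For $A\subseteq P$, ${\downarrow^{\circ}}A:=\{y: y\le a\text{ for some }a\in A\}\setminus A$, ${\uparrow_{\circ}}A:=\{y: y\ge a\text{ for some }a\in A\}\setminus A$. The EV-system $\mathcal{E}(P)$ is the set of triples $(x,D,U)$ with $x\in P$, $D\subseteq{\downarrow^{\circ}}\{x\}$, $U\subseteq{\uparrow_{\circ}}\{x\}$; $\mathfrak a<_+\mathfrak b$ iff $\mathfrak a_1\in\mathfrak b_2$ and $\mathfrak b_1\in\mathfrak a_3$; $\le_+$ is $<_+$ plus equality. For $\xi\in\mathcal{H}(P,Q)$, $\alpha_{P,\xi}(x):=(\xi(x),\xi({\downarrow^{\circ}}G_\xi(x)),\xi({\uparrow_{\circ}}G_\xi(x)))$.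 A Hom-scheme from $R$ to $S$ is a family $(\rho_P)_{P\in\mathfrak{P}_r}$ of maps $\rho_P:\mathcal{H}(P,R)\to\mathcal{H}(P,S)$; strong if every $\rho_P$ is injective; a G-scheme if $G_{\rho_P(\xi)}(x)=G_\xi(x)$ for all $P,\xi,x$; an I-scheme if for all $P,P'\in\mathfrak{P}_r$, $\xi\in\mathcal{H}(P,R)$, $\zeta\in\mathcal{H}(P',R)$, $x\in P$, $y\in P'$: $\alpha_{P,\xi}(x)\le_+\alpha_{P',\zeta}(y)$ implies $\alpha_{P,\rho_P(\xi)}(x)\le_+\alpha_{P',\rho_{P'}(\zeta)}(y)$, with $<_+$ preserved. $R\sqsubseteq S$, $R\sqsubseteq_G S$, $R\sqsubseteq_I S$ mean that a strong Hom-scheme, strong G-scheme, strong I-scheme from $R$ to $S$ exists, respectively. -}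

module Defs where

open import Level using (0ℓ)
open import Data.Nat using (ℕ; suc)
open import Data.Bool using (Bool; T)
open import Data.Bool.Properties using (T?)
open import Data.Fin using (Fin)
open import Data.Fin.Properties using (all?)
open import Data.Vec using (Vec; lookup)
open import Data.Product using (Σ; ∃; _×_; _,_; proj₁; proj₂)
open import Data.Sum using (_⊎_)
open import Relation.Nullary using (¬_)
open import Relation.Nullary.Decidable using (True; _→-dec_)
open import Relation.Unary using (Pred)
open import Relation.Binary.PropositionalEquality using (_≡_; _≢_)
open import Function.Bundles using (_⇔_)
open import Function.Definitions using (Injective)

record FinPoset : Set where
  field
    size    : ℕ
    le      : Fin (suc size) → Fin (suc size) → Bool
    refl    : ∀ x → T (le x x)
    antisym : ∀ x y → T (le x y) → T (le y x) → x ≡ y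
    trans   : ∀ x y z → T (le x y) → T (le y z) → T (le x z)

open FinPoset public

Carrier : FinPoset → Set
Carrier P = Fin (suc (size P))

_⊢_≤_ : (P : FinPoset) → Carrier P → Carrier P → Set
P ⊢ x ≤ y = T (le P x y)

_⊢_<_ : (P : FinPoset) → Carrier P → Carrier P → Set
P ⊢ x < y = P ⊢ x ≤ y × x ≢ y

Comparable : (P : FinPoset) → Carrier P → Carrier P → Set
Comparable P x y = P ⊢ x < y ⊎ P ⊢ y < x

dual : FinPoset → FinPoset
dual P = record
  { size    = size P
  ; le      = λ x y → le P y x
  ; refl    = refl P
  ; antisym = λ x y p q → antisym P x y q p
  ; trans   = λ x y z p q → trans P z y x q p
  }

_≃_ : FinPoset → FinPoset → Set
R ≃ S = Σ (Carrier R → Carrier S) λ f → Σ (Carrier S → Carrier R) λ g →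
        (∀ x → g (f x) ≡ x) × (∀ y → f (g y) ≡ y) ×
        (∀ x y → (R ⊢ x ≤ y) ⇔ (S ⊢ f x ≤ f y))

-- Order-preserving maps H(P,Q), as vectors of values (so that equality
-- is extensional); the monotonicity witness is proof-irrelevant.

IsHom : (P Q : FinPoset) → Vec (Carrier Q) (suc (size P)) → Set
IsHom P Q v = ∀ x y → P ⊢ x ≤ y → Q ⊢ lookup v x ≤ lookup v y

isHom? : (P Q : FinPoset) (v : Vec (Carrier Q) (suc (size P))) →
         Relation.Nullary.Dec (IsHom P Q v)
isHom? P Q v = all? λ x → all? λ y → T? (le P x y) →-dec T? (le Q (lookup v x) (lookup v y))

record Hom (P Q : FinPoset) : Set where
  constructor hom
  field
    vals : Vec (Carrier Q) (suc (size P))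
    mono : True (isHom? P Q vals)

open Hom public

app : {P Q : FinPoset} → Hom P Q → Carrier P → Carrier Q
app ξ x = lookup (vals ξ) x

data Chain (P : FinPoset) (A : Pred (Carrier P) 0ℓ) (x : Carrier P) :
           Carrier P → Set where
  start : Chain P A x x
  step  : ∀ {y z} → Chain P A x y → A z → Comparable P y z → Chain P A x z

γ : (P : FinPoset) → Pred (Carrier P) 0ℓ → Carrier P → Pred (Carrier P) 0ℓ
γ P A x = Chain P A x

G : {P Q : FinPoset} → Hom P Q → Carrier P → Pred (Carrier P) 0ℓ
G {P} ξ x = γ P (λ z → app ξ z ≡ app ξ x) x

down° : (P : FinPoset) → Pred (Carrier P) 0ℓ → Pred (Carrier P) 0ℓ
down° P A y = (∃ λ a → A a × P ⊢ y ≤ a) × ¬ A y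

up° : (P : FinPoset) → Pred (Carrier P) 0ℓ → Pred (Carrier P) 0ℓ
up° P A y = (∃ λ a → A a × P ⊢ a ≤ y) × ¬ A y

image : {P Q : FinPoset} → Hom P Q → Pred (Carrier P) 0ℓ → Pred (Carrier Q) 0ℓ
image ξ A r = ∃ λ y → A y × app ξ y ≡ r

record EV (Q : FinPoset) : Set₁ where
  constructor ev
  field
    pt : Carrier Q
    D  : Pred (Carrier Q) 0ℓ
    U  : Pred (Carrier Q) 0ℓ

open EV public

_<₊_ : {Q : FinPoset} → EV Q → EV Q → Set
a <₊ b = D b (pt a) × U a (pt b)

_≈EV_ : {Q : FinPoset} → EV Q → EV Q → Set
a ≈EV b = pt a ≡ pt b × (∀ r → D a r ⇔ D b r) × (∀ r → U a r ⇔ U b r)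

_≤₊_ : {Q : FinPoset} → EV Q → EV Q → Set
a ≤₊ b = a <₊ b ⊎ a ≈EV b

α : {P Q : FinPoset} → Hom P Q → Carrier P → EV Q
α {P} ξ x = ev (app ξ x) (image ξ (down° P (G ξ x))) (image ξ (up° P (G ξ x)))

HomScheme : FinPoset → FinPoset → Set
HomScheme R S = (P : FinPoset) → Hom P R → Hom P S

Strong : {R S : FinPoset} → HomScheme R S → Set
Strong ρ = ∀ P → Injective _≡_ _≡_ (ρ P)

IsGScheme : {R S : FinPoset} → HomScheme R S → Set
IsGScheme ρ = ∀ P (ξ : Hom P _) x y → G (ρ P ξ) x y ⇔ G ξ x y

IsIScheme : {R S : FinPoset} → HomScheme R S → Set
IsIScheme {R} ρ = ∀ P P' (ξ : Hom P R) (ζ : Hom P' R) x y →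
  (α ξ x ≤₊ α ζ y → α (ρ P ξ) x ≤₊ α (ρ P' ζ) y) ×
  (α ξ x <₊ α ζ y → α (ρ P ξ) x <₊ α (ρ P' ζ) y)

_⊑_ : FinPoset → FinPoset → Set
R ⊑ S = Σ (HomScheme R S) Strong

_⊑G_ : FinPoset → FinPoset → Set
R ⊑G S = Σ (HomScheme R S) λ ρ → Strong ρ × IsGScheme ρ

_⊑I_ : FinPoset → FinPoset → Set
R ⊑I S = Σ (HomScheme R S) λ ρ → Strong ρ × IsIScheme ρ

-- Reading a homomorphism P → Q as a homomorphism Pᵈ → Qᵈ changes neither its values nor the sets
-- G_ξ(x), and it exchanges the D- and U-components of α. Conjugating a Hom-scheme by this reading
-- therefore preserves strength, the G-property and (with ≤₊ and <₊ reversed twice) the I-property,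
-- which gives the first three equivalences.
--
-- A strong scheme R → Rᵈ and its dual give |H(P,R)| = |H(P,Rᵈ)| for every P. As in Lovász's
-- theorem, these numbers determine, for all lists E and F of pairs of points of P, the number of
-- homomorphisms identifying the pairs in E and separating those in F: separations are removed by
-- inclusion–exclusion, and identifying a pair a ≠ b reduces to identifying an adjacent pair (one
-- with no point strictly between), that is, to mapping out of the smaller poset obtained by merging
-- it. With E empty and F all pairs of distinct points, the identity of R yields an injective
-- order-reversing f : R → R. As (x , y) ↦ (f y , f x) injects the finite set of comparable pairs
-- into itself, it is onto, so f also reflects the order and R ≃ Rᵈ. Conversely, composing with an
-- isomorphism R ≃ Rᵈ is a strong scheme.

module Submission where

open import Defs renaming (refl to reflexive; antisym to antisymmetric; trans to transitive)
open import Level using (0ℓ)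
open import Data.Nat using (ℕ; zero; suc; _≤_; _<_; _+_; z≤n; s≤s)
open import Data.Nat.Properties using (≤-refl; ≤-antisym; <-irrefl; +-suc; +-cancelˡ-≡; ≤-pred; module ≤-Reasoning)
open import Data.Bool using (Bool; T)
open import Data.Bool.Properties using (T-irrelevant; T?)
open import Data.Fin using (Fin; zero; punchIn; punchOut)
import Data.Fin.Properties as Fin
open import Data.Vec using (Vec; []; _∷_; tabulate)
open import Data.Vec.Properties using (lookup∘tabulate; ∷-injective)
open import Data.Vec.Relation.Binary.Pointwise.Extensional using (ext; Pointwise-≡⇒≡)
open import Data.List using (List; []; _∷_; length; map; filter; allFin; cartesianProduct; cartesianProductWith)
open import Data.List.Properties using (length-map; length-removeAt′; filter-≐; filter-all; filter-accept; filter-reject)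
open import Data.List.Membership.Propositional using (_∈_)
open import Data.List.Membership.Propositional.Properties
  using (∈-map⁺; ∈-map⁻; ∈-filter⁺; ∈-filter⁻; ∈-allFin; ∈-cartesianProduct⁺; ∈-cartesianProductWith⁺)
import Data.List.Membership.DecPropositional as DecMembership
open import Data.List.Relation.Binary.Subset.Propositional using (_⊆_)
open import Data.List.Relation.Unary.Any using (here; there; index; _─_)
open import Data.List.Relation.Unary.All as All using (All; []; _∷_; all?)
import Data.List.Relation.Unary.All.Properties as All
open import Data.List.Relation.Unary.AllPairs using ([]; _∷_)
open import Data.List.Relation.Unary.Unique.Propositional using (Unique)
import Data.List.Relation.Unary.Unique.Propositional.Properties as Unique
open import Data.Product using (∃; ∃₂; _×_; _,_; proj₁; proj₂; uncurry)
import Data.Product.Properties as Product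
open import Data.Sum using (_⊎_; inj₁; inj₂)
open import Function using (_∘_; id)
open import Function.Bundles using (_⇔_; mk⇔; Equivalence)
import Function.Properties.Equivalence as ⇔
open import Function.Definitions using (Injective)
open import Relation.Nullary using (Dec; yes; no; ¬?; contradiction)
open import Relation.Nullary.Decidable using (isYes; toWitness; fromWitness; map′; _×-dec_; _⊎-dec_)
open import Relation.Unary using (Pred; Decidable; ∁; _∩_; _≐_)
open import Relation.Unary.Properties using (_∩?_; ∁?)
open import Relation.Binary.Definitions using (DecidableEquality)
open import Relation.Binary.PropositionalEquality
  using (_≡_; _≢_; refl; sym; trans; cong; cong₂; subst; subst₂; module ≡-Reasoning)

open Equivalence using (to; from)

private
  variable
    A B : Set

-- Injections between finite lists

∈-─ : ∀ {w z} {ys : List A} (z∈ys : z ∈ ys) → w ∈ ys → w ≢ z → w ∈ (ys ─ z∈ys)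
∈-─ (here refl) (here refl) w≢z = contradiction refl w≢z
∈-─ (here _)    (there w∈ys) _  = w∈ys
∈-─ (there _)   (here refl)  _  = here refl
∈-─ (there z∈ys) (there w∈ys) w≢z = there (∈-─ z∈ys w∈ys w≢z)

unique⇒length-mono-⊆ : ∀ {xs ys : List A} → Unique xs → xs ⊆ ys → length xs ≤ length ys
unique⇒length-mono-⊆ {xs = []} _ _ = z≤n
unique⇒length-mono-⊆ {xs = x ∷ xs} {ys} (x∉xs ∷ xs!) xs⊆ys = begin
  suc (length xs)          ≤⟨ s≤s (unique⇒length-mono-⊆ xs! xs⊆ys─x) ⟩
  suc (length (ys ─ x∈ys)) ≡⟨ length-removeAt′ ys (index x∈ys) ⟨
  length ys                ∎
  where
  open ≤-Reasoning
  x∈ys = xs⊆ys (here refl)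
  xs⊆ys─x : xs ⊆ (ys ─ x∈ys)
  xs⊆ys─x w∈xs = ∈-─ x∈ys (xs⊆ys (there w∈xs)) (λ w≡x → All.lookup x∉xs w∈xs (sym w≡x))

map-⊆ : ∀ {f : A → B} {xs ys} → (∀ {x} → x ∈ xs → f x ∈ ys) → map f xs ⊆ ys
map-⊆ {f = f} f[xs]⊆ys y∈fxs with x , x∈xs , refl ← ∈-map⁻ f y∈fxs = f[xs]⊆ys x∈xs

length-≤-injection : ∀ {f : A → B} {xs ys} → Unique xs → Injective _≡_ _≡_ f →
                     (∀ {x} → x ∈ xs → f x ∈ ys) → length xs ≤ length ys
length-≤-injection {f = f} {xs} xs! f-inj f[xs]⊆ys =
  subst (_≤ _) (length-map f xs) (unique⇒length-mono-⊆ (Unique.map⁺ f-inj xs!) (map-⊆ f[xs]⊆ys))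

length-≡-bijection : ∀ {f : A → B} {xs ys} → Unique xs → Unique ys → Injective _≡_ _≡_ f →
                     (∀ {x} → x ∈ xs → f x ∈ ys) → ys ⊆ map f xs → length xs ≡ length ys
length-≡-bijection {f = f} {xs} xs! ys! f-inj f[xs]⊆ys ys⊆f[xs] = ≤-antisym
  (length-≤-injection xs! f-inj f[xs]⊆ys)
  (subst (_ ≤_) (length-map f xs) (unique⇒length-mono-⊆ ys! ys⊆f[xs]))

module _ (_≟_ : DecidableEquality A) where
  open DecMembership _≟_ using (_∈?_)

  injection-onto : ∀ {f : A → A} {xs} → Unique xs → Injective _≡_ _≡_ f →
                   (∀ {x} → x ∈ xs → f x ∈ xs) → xs ⊆ map f xs
  injection-onto {f = f} {xs} xs! f-inj f[xs]⊆xs {y} y∈xs with y ∈? map f xs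
  ... | yes y∈fxs = y∈fxs
  ... | no  y∉fxs = contradiction
      (subst (λ n → suc n ≤ length xs) (length-map f xs) (unique⇒length-mono-⊆ y∷fxs! y∷fxs⊆xs))
      (<-irrefl refl)
    where
    y∷fxs! : Unique (y ∷ map f xs)
    y∷fxs! = All.tabulate (λ z∈fxs y≡z → y∉fxs (subst (_∈ _) (sym y≡z) z∈fxs)) ∷ Unique.map⁺ f-inj xs!
    y∷fxs⊆xs : y ∷ map f xs ⊆ xs
    y∷fxs⊆xs (here refl) = y∈xs
    y∷fxs⊆xs (there z∈fxs) = map-⊆ f[xs]⊆xs z∈fxs

∈⇒0<length : ∀ {x} {xs : List A} → x ∈ xs → 0 < length xs
∈⇒0<length (here _)  = s≤s z≤n
∈⇒0<length (there _) = s≤s z≤n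

0<length⇒∈ : ∀ {xs : List A} → 0 < length xs → ∃ (_∈ xs)
0<length⇒∈ {xs = x ∷ _} _ = x , here refl

length-filter-∩∁ : {P Q : Pred A 0ℓ} (P? : Decidable P) (Q? : Decidable Q) (xs : List A) →
                   length (filter P? xs) ≡ length (filter (P? ∩? Q?) xs) + length (filter (P? ∩? ∁? Q?) xs)
length-filter-∩∁ P? Q? [] = refl
length-filter-∩∁ P? Q? (x ∷ xs) with P? x | Q? x
... | yes _ | yes _ = cong suc (length-filter-∩∁ P? Q? xs)
... | yes _ | no  _ = trans (cong suc (length-filter-∩∁ P? Q? xs)) (sym (+-suc _ _))
... | no  _ | _     = length-filter-∩∁ P? Q? xs

-- Homomorphisms and their enumeration

private
  variable
    P Q R S X Y : FinPoset

Monotone : (P Q : FinPoset) → (Carrier P → Carrier Q) → Set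
Monotone P Q f = ∀ {x y} → P ⊢ x ≤ y → Q ⊢ f x ≤ f y

app-mono : (ξ : Hom P Q) → Monotone P Q (app ξ)
app-mono ξ = toWitness (mono ξ) _ _

toHom : (f : Carrier P → Carrier Q) → Monotone P Q f → Hom P Q
toHom {P} {Q} f f-mono = hom (tabulate f) (fromWitness λ x y x≤y →
  subst₂ (Q ⊢_≤_) (sym (lookup∘tabulate f x)) (sym (lookup∘tabulate f y)) (f-mono x≤y))

app-toHom : ∀ (f : Carrier P → Carrier Q) (f-mono : Monotone P Q f) x → app (toHom {P} {Q} f f-mono) x ≡ f x
app-toHom f _ = lookup∘tabulate f

vals-injective : {ξ η : Hom P Q} → vals ξ ≡ vals η → ξ ≡ η
vals-injective {ξ = hom v m} {hom .v m′} refl = cong (hom v) (T-irrelevant m m′)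

hom-ext : {ξ η : Hom P Q} → (∀ x → app ξ x ≡ app η x) → ξ ≡ η
hom-ext ξ≗η = vals-injective (Pointwise-≡⇒≡ (ext ξ≗η))

vectors : (q n : ℕ) → List (Vec (Fin q) n)
vectors q zero    = [] ∷ []
vectors q (suc n) = cartesianProductWith _∷_ (allFin q) (vectors q n)

∈-vectors : ∀ {q n} (v : Vec (Fin q) n) → v ∈ vectors q n
∈-vectors []      = here refl
∈-vectors (x ∷ v) = ∈-cartesianProductWith⁺ _∷_ (∈-allFin x) (∈-vectors v)

vectors-unique : ∀ q n → Unique (vectors q n)
vectors-unique q zero    = [] ∷ []
vectors-unique q (suc n) = Unique.cartesianProductWith⁺ _∷_ ∷-injective (Unique.allFin⁺ q) (vectors-unique q n)

homsAmong : (P Q : FinPoset) → List (Vec (Carrier Q) (suc (size P))) → List (Hom P Q)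
homsAmong P Q [] = []
homsAmong P Q (v ∷ vs) with isHom? P Q v
... | yes v-mono = hom v (fromWitness v-mono) ∷ homsAmong P Q vs
... | no  _      = homsAmong P Q vs

vals-homsAmong : ∀ vs → map vals (homsAmong P Q vs) ≡ filter (isHom? P Q) vs
vals-homsAmong [] = refl
vals-homsAmong {P} {Q} (v ∷ vs) with isHom? P Q v
... | yes v-mono = trans (cong (v ∷_) (vals-homsAmong vs)) (sym (filter-accept (isHom? P Q) v-mono))
... | no ¬v-mono = trans (vals-homsAmong vs) (sym (filter-reject (isHom? P Q) ¬v-mono))

candidates : (P Q : FinPoset) → List (Vec (Carrier Q) (suc (size P)))
candidates P Q = vectors (suc (size Q)) (suc (size P))

opaque
  homs : (P Q : FinPoset) → List (Hom P Q)
  homs P Q = homsAmong P Q (candidates P Q)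

  ∈-homs : (ξ : Hom P Q) → ξ ∈ homs P Q
  ∈-homs {P} {Q} ξ
    with η , η∈homs , vξ≡vη ← ∈-map⁻ vals (subst (vals ξ ∈_) (sym (vals-homsAmong (candidates P Q)))
                                   (∈-filter⁺ (isHom? P Q) (∈-vectors (vals ξ)) (toWitness (mono ξ))))
    = subst (_∈ homs P Q) (vals-injective (sym vξ≡vη)) η∈homs

  homs-unique : ∀ P Q → Unique (homs P Q)
  homs-unique P Q = Unique.map⁻ (subst Unique (sym (vals-homsAmong (candidates P Q)))
                      (Unique.filter⁺ (isHom? P Q) (vectors-unique _ _)))

-- Duality

dualHom : Hom P Q → Hom (dual P) (dual Q)
dualHom ξ = hom (vals ξ) (fromWitness λ x y → app-mono ξ)

-- The map of dualHom, but with codomain Q rather than dual (dual Q), which is only η-equal to Q.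
undual : Hom P (dual Q) → Hom (dual P) Q
undual ξ = hom (vals ξ) (fromWitness λ x y → app-mono ξ)

dualHom-injective : {ξ η : Hom P Q} → dualHom ξ ≡ dualHom η → ξ ≡ η
dualHom-injective = vals-injective ∘ cong vals

undual-injective : {ξ η : Hom P (dual Q)} → undual ξ ≡ undual η → ξ ≡ η
undual-injective = vals-injective ∘ cong vals

dualScheme : HomScheme R S → HomScheme (dual R) (dual S)
dualScheme ρ P = dualHom ∘ ρ (dual P) ∘ undual

dualScheme-strong : (ρ : HomScheme R S) → Strong ρ → Strong (dualScheme ρ)
dualScheme-strong ρ ρ-strong P = undual-injective ∘ ρ-strong (dual P) ∘ dualHom-injective

comparable-dual : {x y : Carrier P} → Comparable P x y → Comparable (dual P) x y
comparable-dual (inj₁ (x≤y , x≢y)) = inj₂ (x≤y , x≢y ∘ sym)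
comparable-dual (inj₂ (y≤x , y≢x)) = inj₁ (y≤x , y≢x ∘ sym)

chain-dual : {A : Pred (Carrier P) 0ℓ} {x y : Carrier P} → Chain P A x y → Chain (dual P) A x y
chain-dual start          = start
chain-dual {P} (step c Az yz) = step (chain-dual c) Az (comparable-dual {P = P} yz)

G-dual : (ξ : Hom P Q) (x y : Carrier P) → G (dualHom ξ) x y ⇔ G ξ x y
G-dual {P} ξ x y = mk⇔ (chain-dual {P = dual P}) (chain-dual {P = P})

G-undual : (ξ : Hom P (dual Q)) (x y : Carrier P) → G (undual ξ) x y ⇔ G ξ x y
G-undual {P} ξ x y = mk⇔ (chain-dual {P = dual P}) (chain-dual {P = P})

dualScheme-G : (ρ : HomScheme R S) → IsGScheme ρ → IsGScheme (dualScheme ρ)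
dualScheme-G ρ ρ-G P ξ x y =
  ⇔.trans (G-dual (ρ (dual P) (undual ξ)) x y) (⇔.trans (ρ-G (dual P) (undual ξ) x y) (G-undual ξ x y))

record Swapped (a : EV Q) (b : EV (dual Q)) : Set where
  field
    pt-≡ : pt a ≡ pt b
    D⇔U  : ∀ r → D a r ⇔ U b r
    U⇔D  : ∀ r → U a r ⇔ D b r

open Swapped

module _ {a b : EV Q} {a′ b′ : EV (dual Q)} (a~a′ : Swapped a a′) (b~b′ : Swapped b b′) where

  <₊-swap : a <₊ b → b′ <₊ a′
  <₊-swap (D-b-a , U-a-b) =
    subst (D a′) (pt-≡ b~b′) (to (U⇔D a~a′ _) U-a-b) ,
    subst (U b′) (pt-≡ a~a′) (to (D⇔U b~b′ _) D-b-a)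

  ≈EV-swap : a ≈EV b → b′ ≈EV a′
  ≈EV-swap (a≡b , Da⇔Db , Ua⇔Ub) =
    trans (sym (pt-≡ b~b′)) (trans (sym a≡b) (pt-≡ a~a′)) ,
    (λ r → ⇔.trans (⇔.sym (U⇔D b~b′ r)) (⇔.trans (⇔.sym (Ua⇔Ub r)) (U⇔D a~a′ r))) ,
    (λ r → ⇔.trans (⇔.sym (D⇔U b~b′ r)) (⇔.trans (⇔.sym (Da⇔Db r)) (D⇔U a~a′ r)))

  ≤₊-swap : a ≤₊ b → b′ ≤₊ a′
  ≤₊-swap (inj₁ a<b) = inj₁ (<₊-swap a<b)
  ≤₊-swap (inj₂ a≈b) = inj₂ (≈EV-swap a≈b)

image-down°-cong : (ξ : Hom P Q) {A B : Pred (Carrier P) 0ℓ} → (∀ z → A z ⇔ B z) →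
                   ∀ r → image ξ (down° P A) r ⇔ image ξ (down° P B) r
image-down°-cong {P} ξ A⇔B r = mk⇔ (image-map A⇔B) (image-map (⇔.sym ∘ A⇔B))
  where
  image-map : {A B : Pred (Carrier P) 0ℓ} → (∀ z → A z ⇔ B z) → image ξ (down° P A) r → image ξ (down° P B) r
  image-map A⇔B (y , ((a , Aa , y≤a) , ¬Ay) , ξy≡r) =
    y , ((a , to (A⇔B a) Aa , y≤a) , ¬Ay ∘ from (A⇔B y)) , ξy≡r

α-dual : (ξ : Hom P Q) (x : Carrier P) → Swapped (α ξ x) (α (dualHom ξ) x)
α-dual ξ x = record
  { pt-≡ = refl
  ; D⇔U  = image-down°-cong ξ (λ z → ⇔.sym (G-dual ξ x z))
  ; U⇔D  = image-down°-cong (dualHom ξ) (λ z → ⇔.sym (G-dual ξ x z))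
  }

α-undual : (ξ : Hom P (dual Q)) (x : Carrier P) → Swapped (α ξ x) (α (undual ξ) x)
α-undual ξ x = record
  { pt-≡ = refl
  ; D⇔U  = image-down°-cong ξ (λ z → ⇔.sym (G-undual ξ x z))
  ; U⇔D  = image-down°-cong (undual ξ) (λ z → ⇔.sym (G-undual ξ x z))
  }

dualScheme-I : (ρ : HomScheme R S) → IsIScheme ρ → IsIScheme (dualScheme ρ)
dualScheme-I ρ ρ-I P P′ ξ ζ x y =
  ≤₊-swap (α-dual ρζ y) (α-dual ρξ x) ∘ proj₁ (ρ-I _ _ (undual ζ) (undual ξ) y x)
    ∘ ≤₊-swap (α-undual ξ x) (α-undual ζ y) ,
  <₊-swap (α-dual ρζ y) (α-dual ρξ x) ∘ proj₂ (ρ-I _ _ (undual ζ) (undual ξ) y x)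
    ∘ <₊-swap (α-undual ξ x) (α-undual ζ y)
  where
  ρξ = ρ (dual P) (undual ξ)
  ρζ = ρ (dual P′) (undual ζ)

dual-⊑ : R ⊑ S → dual R ⊑ dual S
dual-⊑ (ρ , ρ-strong) = dualScheme ρ , dualScheme-strong ρ ρ-strong

dual-⊑G : R ⊑G S → dual R ⊑G dual S
dual-⊑G (ρ , ρ-strong , ρ-G) = dualScheme ρ , dualScheme-strong ρ ρ-strong , dualScheme-G ρ ρ-G

dual-⊑I : R ⊑I S → dual R ⊑I dual S
dual-⊑I (ρ , ρ-strong , ρ-I) = dualScheme ρ , dualScheme-strong ρ ρ-strong , dualScheme-I ρ ρ-I

-- Counting homomorphisms that identify and separate given pairs

record Pair (P : FinPoset) : Set where
  constructor pair
  field
    fst snd : Carrier P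

open Pair

Identifies : Hom P X → Pred (Pair P) 0ℓ
Identifies ξ e = app ξ (fst e) ≡ app ξ (snd e)

identifies? : (ξ : Hom P X) → Decidable (Identifies ξ)
identifies? ξ e = app ξ (fst e) Fin.≟ app ξ (snd e)

record Constrained (E F : List (Pair P)) (ξ : Hom P X) : Set where
  constructor constrained
  field
    identified : All (Identifies ξ) E
    separated  : All (∁ (Identifies ξ)) F

opaque
  constrained? : (E F : List (Pair P)) → Decidable (Constrained {X = X} E F)
  constrained? E F ξ = map′ (uncurry constrained) (λ (constrained Es Fs) → Es , Fs)
                            (all? (identifies? ξ) E ×-dec all? (∁? (identifies? ξ)) F)

count : (P X : FinPoset) → List (Pair P) → List (Pair P) → ℕ
count P X E F = length (filter (constrained? {X = X} E F) (homs P X))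

count-unconstrained : ∀ P X → count P X [] [] ≡ length (homs P X)
count-unconstrained P X =
  cong length (filter-all (constrained? {X = X} [] []) {xs = homs P X} (All.tabulate λ _ → constrained [] []))

count-split : ∀ e (E F : List (Pair P)) → count P X E F ≡ count P X (e ∷ E) F + count P X E (e ∷ F)
count-split {P} {X} e E F = trans
  (length-filter-∩∁ (constrained? {X = X} E F) (λ ξ → identifies? ξ e) (homs P X))
  (cong₂ _+_ (cong length (filter-≐ _ _ e-identified (homs P X)))
             (cong length (filter-≐ _ _ e-separated (homs P X))))
  where
  e-identified : (Constrained E F ∩ λ ξ → Identifies ξ e) ≐ Constrained {X = X} (e ∷ E) F
  e-identified = (λ (constrained Es Fs , Ie) → constrained (Ie ∷ Es) Fs) ,
                 λ { (constrained (Ie ∷ Es) Fs) → constrained Es Fs , Ie }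
  e-separated : (Constrained E F ∩ ∁ λ ξ → Identifies ξ e) ≐ Constrained {X = X} E (e ∷ F)
  e-separated = (λ (constrained Es Fs , ¬Ie) → constrained Es (¬Ie ∷ Fs)) ,
                λ { (constrained Es (¬Ie ∷ Fs)) → constrained Es Fs , ¬Ie }

infix 4 _≋_
_≋_ : List (Pair P) → List (Pair P) → Set
_≋_ {P} E E′ = ∀ {X} (ξ : Hom P X) → All (Identifies ξ) E ⇔ All (Identifies ξ) E′

count-cong : {E E′ : List (Pair P)} → E ≋ E′ → ∀ X F → count P X E F ≡ count P X E′ F
count-cong {P} E≋E′ X F = cong length (filter-≐ (constrained? {X = X} _ _) (constrained? {X = X} _ _)
  ((λ {ξ} (constrained Es Fs) → constrained (to (E≋E′ ξ) Es) Fs) ,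
   (λ {ξ} (constrained Es Fs) → constrained (from (E≋E′ ξ) Es) Fs)) (homs P X))

identify-refl : ∀ (a : Carrier P) (E : List (Pair P)) → pair a a ∷ E ≋ E
identify-refl a E ξ = mk⇔ All.tail (refl ∷_)

identify-sym : ∀ (a b : Carrier P) (E : List (Pair P)) → pair a b ∷ E ≋ pair b a ∷ E
identify-sym a b E ξ = mk⇔ (λ { (e ∷ Es) → sym e ∷ Es }) (λ { (e ∷ Es) → sym e ∷ Es })

identify-through : ∀ {a m b : Carrier P} (E : List (Pair P)) → P ⊢ a ≤ m → P ⊢ m ≤ b →
                   pair a b ∷ E ≋ pair a m ∷ pair m b ∷ E
identify-through {a = a} {m} {b} E a≤m m≤b {X} ξ = mk⇔
  (λ { (ξa≡ξb ∷ Es) → let ξa≡ξm = antisymmetric X _ _ (app-mono ξ a≤m)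
                                     (subst (X ⊢ app ξ m ≤_) (sym ξa≡ξb) (app-mono ξ m≤b))
                      in ξa≡ξm ∷ trans (sym ξa≡ξm) ξa≡ξb ∷ Es })
  (λ { (ξa≡ξm ∷ ξm≡ξb ∷ Es) → trans ξa≡ξm ξm≡ξb ∷ Es })

-- Merging an adjacent pair

NothingBetween : (P : FinPoset) → Carrier P → Carrier P → Set
NothingBetween P a b = ∀ c → P ⊢ a ≤ c → P ⊢ c ≤ b → c ≡ a ⊎ c ≡ b

record Adjacent (P : FinPoset) (a b : Carrier P) : Set where
  field
    distinct : a ≢ b
    upward   : NothingBetween P a b
    downward : NothingBetween P b a

module _ (P : FinPoset) {p : Pred (Carrier P) 0ℓ} (p? : Decidable p) where

  MinimalAmong : List (Carrier P) → Carrier P → Set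
  MinimalAmong xs m = p m × ∀ {c} → c ∈ xs → p c → P ⊢ c ≤ m → c ≡ m

  minimal-among : ∀ xs → ∃ (MinimalAmong xs) ⊎ All (∁ p) xs
  minimal-among [] = inj₂ []
  minimal-among (x ∷ xs) with p? x | minimal-among xs
  ... | no ¬px | inj₂ none = inj₂ (¬px ∷ none)
  ... | no ¬px | inj₁ (m , pm , min) =
    inj₁ (m , pm , λ { (here refl) px _ → contradiction px ¬px ; (there c∈xs) → min c∈xs })
  ... | yes px | inj₂ none =
    inj₁ (x , px , λ { (here refl) _ _ → refl ; (there c∈xs) pc _ → contradiction pc (All.lookup none c∈xs) })
  ... | yes px | inj₁ (m , pm , min) with T? (le P x m)
  ...   | no x≰m = inj₁ (m , pm , λ { (here refl) _ x≤m → contradiction x≤m x≰m ; (there c∈xs) → min c∈xs })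
  ...   | yes x≤m = inj₁ (x , px , λ { (here refl) _ _ → refl ; (there c∈xs) pc c≤x → below-x c∈xs pc c≤x })
    where
    below-x : ∀ {c} → c ∈ xs → p c → P ⊢ c ≤ x → c ≡ x
    below-x c∈xs pc c≤x =
      let c≡m = min c∈xs pc (transitive P _ _ _ c≤x x≤m)
      in trans c≡m (antisymmetric P _ _ (subst (λ c → P ⊢ c ≤ x) c≡m c≤x) x≤m)

  minimal : ∀ {x} → p x → ∃ λ m → p m × ∀ c → p c → P ⊢ c ≤ m → c ≡ m
  minimal {x} px with minimal-among (allFin _)
  ... | inj₁ (m , pm , min) = m , pm , λ c → min (∈-allFin c)
  ... | inj₂ none           = contradiction px (All.lookup none (∈-allFin x))

cover-between : (P : FinPoset) {a b : Carrier P} → P ⊢ a ≤ b → a ≢ b →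
        ∃ λ m → Adjacent P a m × P ⊢ a ≤ m × P ⊢ m ≤ b
cover-between P {a} {b} a≤b a≢b
  with m , (a≤m , m≤b , a≢m) , min ← minimal P (λ c → T? (le P a c) ×-dec T? (le P c b) ×-dec ¬? (a Fin.≟ c))
                                                (a≤b , reflexive P b , a≢b)
  = m , record { distinct = a≢m ; upward = upward ; downward = downward } , a≤m , m≤b
  where
  upward : NothingBetween P a m
  upward c a≤c c≤m with a Fin.≟ c
  ... | yes a≡c = inj₁ (sym a≡c)
  ... | no  a≢c = inj₂ (min c (a≤c , transitive P _ _ _ c≤m m≤b , a≢c) c≤m)
  downward : NothingBetween P m a
  downward c m≤c c≤a = inj₂ (antisymmetric P c a c≤a (transitive P _ _ _ a≤m m≤c))

adjacent-reduction : (P : FinPoset) {a b : Carrier P} → a ≢ b → (E : List (Pair P)) →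
                     ∃₂ λ a′ b′ → Adjacent P a′ b′ × ∃ λ E′ → pair a b ∷ E ≋ pair a′ b′ ∷ E′
adjacent-reduction P {a} {b} a≢b E with T? (le P a b) | T? (le P b a)
... | yes a≤b | _ with m , adj , a≤m , m≤b ← cover-between P a≤b a≢b =
  a , m , adj , pair m b ∷ E , identify-through E a≤m m≤b
... | no _ | yes b≤a with m , adj , b≤m , m≤a ← cover-between P b≤a (a≢b ∘ sym) =
  b , m , adj , pair m a ∷ E , λ ξ → ⇔.trans (identify-sym a b E ξ) (identify-through E b≤m m≤a ξ)
... | no a≰b | no b≰a = a , b , adj , E , λ _ → ⇔.refl
  where
  adj : Adjacent P a b
  adj = record
    { distinct = a≢b
    ; upward   = λ c a≤c c≤b → contradiction (transitive P _ _ _ a≤c c≤b) a≰b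
    ; downward = λ c b≤c c≤a → contradiction (transitive P _ _ _ b≤c c≤a) b≰a
    }

-- The poset is given by its fields so that its carrier is definitionally Fin (2 + k), leaving
-- Fin (1 + k) for the merged poset P/ab.
module Merging {k : ℕ} (_≤ᵇ_ : Fin (suc (suc k)) → Fin (suc (suc k)) → Bool)
  (≤ᵇ-refl    : ∀ x → T (x ≤ᵇ x))
  (≤ᵇ-antisym : ∀ x y → T (x ≤ᵇ y) → T (y ≤ᵇ x) → x ≡ y)
  (≤ᵇ-trans   : ∀ x y z → T (x ≤ᵇ y) → T (y ≤ᵇ z) → T (x ≤ᵇ z))
  where

  P⁺ : FinPoset
  P⁺ = record { size = suc k ; le = _≤ᵇ_ ; refl = ≤ᵇ-refl ; antisym = ≤ᵇ-antisym ; trans = ≤ᵇ-trans }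

  module Quotient {a b : Carrier P⁺} (adj : Adjacent P⁺ a b) where
    open Adjacent adj

    infix 4 _≤⁺_ _≼_ _≼?_

    _≤⁺_ : Carrier P⁺ → Carrier P⁺ → Set
    x ≤⁺ y = P⁺ ⊢ x ≤ y

    ≤⁺-trans : ∀ {x y z} → x ≤⁺ y → y ≤⁺ z → x ≤⁺ z
    ≤⁺-trans = ≤ᵇ-trans _ _ _

    -- the order of P/ab, on representatives in P⁺
    _≼_ : Carrier P⁺ → Carrier P⁺ → Set
    x ≼ y = x ≤⁺ y ⊎ (x ≤⁺ a × b ≤⁺ y) ⊎ (x ≤⁺ b × a ≤⁺ y)

    _≼?_ : ∀ x y → Dec (x ≼ y)
    x ≼? y = T? (x ≤ᵇ y) ⊎-dec (T? (x ≤ᵇ a) ×-dec T? (b ≤ᵇ y)) ⊎-dec (T? (x ≤ᵇ b) ×-dec T? (a ≤ᵇ y))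

    ≼-trans : ∀ {x y z} → x ≼ y → y ≼ z → x ≼ z
    ≼-trans (inj₁ x≤y)               (inj₁ y≤z)               = inj₁ (≤⁺-trans x≤y y≤z)
    ≼-trans (inj₁ x≤y)               (inj₂ (inj₁ (y≤a , b≤z))) = inj₂ (inj₁ (≤⁺-trans x≤y y≤a , b≤z))
    ≼-trans (inj₁ x≤y)               (inj₂ (inj₂ (y≤b , a≤z))) = inj₂ (inj₂ (≤⁺-trans x≤y y≤b , a≤z))
    ≼-trans (inj₂ (inj₁ (x≤a , b≤y))) (inj₁ y≤z)               = inj₂ (inj₁ (x≤a , ≤⁺-trans b≤y y≤z))
    ≼-trans (inj₂ (inj₁ (x≤a , _)))   (inj₂ (inj₁ (_ , b≤z)))   = inj₂ (inj₁ (x≤a , b≤z))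
    ≼-trans (inj₂ (inj₁ (x≤a , _)))   (inj₂ (inj₂ (_ , a≤z)))   = inj₁ (≤⁺-trans x≤a a≤z)
    ≼-trans (inj₂ (inj₂ (x≤b , a≤y))) (inj₁ y≤z)               = inj₂ (inj₂ (x≤b , ≤⁺-trans a≤y y≤z))
    ≼-trans (inj₂ (inj₂ (x≤b , _)))   (inj₂ (inj₁ (_ , b≤z)))   = inj₁ (≤⁺-trans x≤b b≤z)
    ≼-trans (inj₂ (inj₂ (x≤b , _)))   (inj₂ (inj₂ (_ , a≤z)))   = inj₂ (inj₂ (x≤b , a≤z))

    Squeezed : Carrier P⁺ → Set
    Squeezed x = (a ≤⁺ x × x ≤⁺ b) ⊎ (b ≤⁺ x × x ≤⁺ a)

    squeezed⇒≡a : ∀ {x} → x ≢ b → Squeezed x → x ≡ a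
    squeezed⇒≡a x≢b (inj₁ (a≤x , x≤b)) with upward _ a≤x x≤b
    ... | inj₁ x≡a = x≡a
    ... | inj₂ x≡b = contradiction x≡b x≢b
    squeezed⇒≡a x≢b (inj₂ (b≤x , x≤a)) with downward _ b≤x x≤a
    ... | inj₁ x≡b = contradiction x≡b x≢b
    ... | inj₂ x≡a = x≡a

    -- Except when x ≤ y ≤ x, a cycle through the merged point squeezes x and y between a and b.
    ≼-antisym : ∀ {x y} → x ≢ b → y ≢ b → x ≼ y → y ≼ x → x ≡ y
    ≼-antisym {x} {y} x≢b y≢b = antisym
      where
      both : Squeezed x → Squeezed y → x ≡ y
      both sx sy = trans (squeezed⇒≡a x≢b sx) (sym (squeezed⇒≡a y≢b sy))
      antisym : x ≼ y → y ≼ x → x ≡ y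
      antisym (inj₁ x≤y) (inj₁ y≤x) = ≤ᵇ-antisym x y x≤y y≤x
      antisym (inj₁ x≤y) (inj₂ (inj₁ (y≤a , b≤x))) = both (inj₂ (b≤x , ≤⁺-trans x≤y y≤a)) (inj₂ (≤⁺-trans b≤x x≤y , y≤a))
      antisym (inj₁ x≤y) (inj₂ (inj₂ (y≤b , a≤x))) = both (inj₁ (a≤x , ≤⁺-trans x≤y y≤b)) (inj₁ (≤⁺-trans a≤x x≤y , y≤b))
      antisym (inj₂ (inj₁ (x≤a , b≤y))) (inj₁ y≤x) = both (inj₂ (≤⁺-trans b≤y y≤x , x≤a)) (inj₂ (b≤y , ≤⁺-trans y≤x x≤a))
      antisym (inj₂ (inj₁ (x≤a , b≤y))) (inj₂ (inj₁ (y≤a , b≤x))) = both (inj₂ (b≤x , x≤a)) (inj₂ (b≤y , y≤a))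
      antisym (inj₂ (inj₁ (_ , b≤y))) (inj₂ (inj₂ (y≤b , _))) = contradiction (≤ᵇ-antisym y b y≤b b≤y) y≢b
      antisym (inj₂ (inj₂ (x≤b , a≤y))) (inj₁ y≤x) = both (inj₁ (≤⁺-trans a≤y y≤x , x≤b)) (inj₁ (a≤y , ≤⁺-trans y≤x x≤b))
      antisym (inj₂ (inj₂ (x≤b , _))) (inj₂ (inj₁ (_ , b≤x))) = contradiction (≤ᵇ-antisym x b x≤b b≤x) x≢b
      antisym (inj₂ (inj₂ (x≤b , a≤y))) (inj₂ (inj₂ (y≤b , a≤x))) = both (inj₁ (a≤x , x≤b)) (inj₁ (a≤y , y≤b))

    ≼-respecting : ∀ {X} (ξ : Hom P⁺ X) → app ξ a ≡ app ξ b → ∀ {x y} → x ≼ y → X ⊢ app ξ x ≤ app ξ y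
    ≼-respecting {X} ξ ξa≡ξb (inj₁ x≤y) = app-mono ξ x≤y
    ≼-respecting {X} ξ ξa≡ξb (inj₂ (inj₁ (x≤a , b≤y))) =
      transitive X _ _ _ (app-mono ξ x≤a) (subst (λ z → X ⊢ z ≤ _) (sym ξa≡ξb) (app-mono ξ b≤y))
    ≼-respecting {X} ξ ξa≡ξb (inj₂ (inj₂ (x≤b , a≤y))) =
      transitive X _ _ _ (app-mono ξ x≤b) (subst (λ z → X ⊢ z ≤ _) ξa≡ξb (app-mono ξ a≤y))

    merge : Carrier P⁺ → Carrier P⁺
    merge x with x Fin.≟ b
    ... | yes _ = a
    ... | no  _ = x

    merge-≢b : ∀ x → b ≢ merge x
    merge-≢b x with x Fin.≟ b
    ... | yes _   = distinct ∘ sym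
    ... | no  x≢b = x≢b ∘ sym

    merge-id : ∀ {x} → x ≢ b → merge x ≡ x
    merge-id {x} x≢b with x Fin.≟ b
    ... | yes x≡b = contradiction x≡b x≢b
    ... | no  _   = refl

    merge-a≡merge-b : merge a ≡ merge b
    merge-a≡merge-b with b Fin.≟ b
    ... | yes _   = merge-id distinct
    ... | no  b≢b = contradiction refl b≢b

    merge-mono : ∀ {x y} → x ≤⁺ y → merge x ≼ merge y
    merge-mono {x} {y} x≤y with x Fin.≟ b | y Fin.≟ b
    ... | yes refl | yes refl = inj₁ (≤ᵇ-refl a)
    ... | yes refl | no  _    = inj₂ (inj₁ (≤ᵇ-refl a , x≤y))
    ... | no  _    | yes refl = inj₂ (inj₂ (x≤y , ≤ᵇ-refl a))
    ... | no  _    | no  _    = inj₁ x≤y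

    merge-respecting : ∀ {X} (ξ : Hom P⁺ X) → app ξ a ≡ app ξ b → ∀ x → app ξ (merge x) ≡ app ξ x
    merge-respecting ξ ξa≡ξb x with x Fin.≟ b
    ... | yes refl = ξa≡ξb
    ... | no  _    = refl

    embed : Fin (suc k) → Carrier P⁺
    embed = punchIn b

    P/ab : FinPoset
    P/ab = record
      { size    = k
      ; le      = λ i j → isYes (embed i ≼? embed j)
      ; refl    = λ i → fromWitness (inj₁ (≤ᵇ-refl (embed i)))
      ; antisym = λ i j i≼j j≼i → Fin.punchIn-injective b i j
                    (≼-antisym (Fin.punchInᵢ≢i b i) (Fin.punchInᵢ≢i b j) (toWitness i≼j) (toWitness j≼i))
      ; trans   = λ i j l i≼j j≼l → fromWitness (≼-trans (toWitness i≼j) (toWitness j≼l))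
      }

    project : Carrier P⁺ → Carrier P/ab
    project x = punchOut (merge-≢b x)

    embed-project : ∀ x → embed (project x) ≡ merge x
    embed-project x = Fin.punchIn-punchOut (merge-≢b x)

    project-embed : ∀ i → project (embed i) ≡ i
    project-embed i = trans (Fin.punchOut-cong b (merge-id (Fin.punchInᵢ≢i b i))) (Fin.punchOut-punchIn b)

    project-mono : Monotone P⁺ P/ab project
    project-mono {x} {y} x≤y = fromWitness (subst₂ _≼_ (sym (embed-project x)) (sym (embed-project y)) (merge-mono x≤y))

    project-a≡project-b : project a ≡ project b
    project-a≡project-b = Fin.punchOut-cong b merge-a≡merge-b

    projectPair : Pair P⁺ → Pair P/ab
    projectPair (pair u v) = pair (project u) (project v)

    module _ (Z : FinPoset) where

      lift : Hom P/ab Z → Hom P⁺ Z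
      lift η = toHom (app η ∘ project) (app-mono η ∘ project-mono)

      app-lift : ∀ η x → app (lift η) x ≡ app η (project x)
      app-lift η = app-toHom {P = P⁺} {Q = Z} (app η ∘ project) (app-mono η ∘ project-mono)

      lift-injective : Injective _≡_ _≡_ lift
      lift-injective {η} {η′} lift-η≡lift-η′ = hom-ext λ i → begin
        app η i                    ≡⟨ cong (app η) (project-embed i) ⟨
        app η (project (embed i))  ≡⟨ app-lift η (embed i) ⟨
        app (lift η) (embed i)     ≡⟨ cong (λ ξ → app ξ (embed i)) lift-η≡lift-η′ ⟩
        app (lift η′) (embed i)    ≡⟨ app-lift η′ (embed i) ⟩
        app η′ (project (embed i)) ≡⟨ cong (app η′) (project-embed i) ⟩
        app η′ i                   ∎
        where open ≡-Reasoning

      restrict : (ξ : Hom P⁺ Z) → app ξ a ≡ app ξ b → Hom P/ab Z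
      restrict ξ ξa≡ξb = toHom (app ξ ∘ embed) (≼-respecting ξ ξa≡ξb ∘ toWitness)

      app-restrict : ∀ ξ ξa≡ξb i → app (restrict ξ ξa≡ξb) i ≡ app ξ (embed i)
      app-restrict ξ ξa≡ξb = app-toHom {P = P/ab} {Q = Z} (app ξ ∘ embed) (≼-respecting ξ ξa≡ξb ∘ toWitness)

      lift-restrict : ∀ ξ ξa≡ξb → lift (restrict ξ ξa≡ξb) ≡ ξ
      lift-restrict ξ ξa≡ξb = hom-ext λ x → begin
        app (lift ξ′) x           ≡⟨ app-lift ξ′ x ⟩
        app ξ′ (project x)        ≡⟨ app-restrict ξ ξa≡ξb (project x) ⟩
        app ξ (embed (project x)) ≡⟨ cong (app ξ) (embed-project x) ⟩
        app ξ (merge x)           ≡⟨ merge-respecting ξ ξa≡ξb x ⟩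
        app ξ x                   ∎
        where
        open ≡-Reasoning
        ξ′ = restrict ξ ξa≡ξb

      lift-identifies : ∀ η e → Identifies (lift η) e ⇔ Identifies η (projectPair e)
      lift-identifies η (pair u v) = mk⇔
        (λ ηu≡ηv → trans (sym (app-lift η u)) (trans ηu≡ηv (app-lift η v)))
        (λ ηu≡ηv → trans (app-lift η u) (trans ηu≡ηv (sym (app-lift η v))))

      count-merged : ∀ E → count P⁺ Z (pair a b ∷ E) [] ≡ count P/ab Z (map projectPair E) []
      count-merged E = sym (length-≡-bijection
        (Unique.filter⁺ constrained-P/ab? (homs-unique P/ab Z))
        (Unique.filter⁺ constrained-P⁺? (homs-unique P⁺ Z))
        lift-injective into onto)
        where
        constrained-P/ab? = constrained? {X = Z} (map projectPair E) []
        constrained-P⁺?   = constrained? {X = Z} (pair a b ∷ E) []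

        into : ∀ {η} → η ∈ filter constrained-P/ab? (homs P/ab Z) → lift η ∈ filter constrained-P⁺? (homs P⁺ Z)
        into {η} η∈ with constrained Es _ ← proj₂ (∈-filter⁻ constrained-P/ab? {xs = homs P/ab Z} η∈) =
          ∈-filter⁺ constrained-P⁺? (∈-homs (lift η)) (constrained
            (from (lift-identifies η (pair a b)) (cong (app η) project-a≡project-b)
              ∷ All.map (λ {e} → from (lift-identifies η e)) (All.map⁻ Es))
            [])

        onto : ∀ {ξ} → ξ ∈ filter constrained-P⁺? (homs P⁺ Z) →
               ξ ∈ map lift (filter constrained-P/ab? (homs P/ab Z))
        onto {ξ} ξ∈ with constrained (ξa≡ξb ∷ Es) _ ← proj₂ (∈-filter⁻ constrained-P⁺? {xs = homs P⁺ Z} ξ∈) =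
          subst (_∈ _) (lift-restrict ξ ξa≡ξb) (∈-map⁺ lift (∈-filter⁺ constrained-P/ab? (∈-homs ξ′)
            (constrained (All.map⁺ (All.map ξ′-identifies Es)) [])))
          where
          ξ′ = restrict ξ ξa≡ξb
          ξ′-identifies : ∀ {e} → Identifies ξ e → Identifies ξ′ (projectPair e)
          ξ′-identifies {e} = to (lift-identifies ξ′ e) ∘ subst (λ ζ → Identifies ζ e) (sym (lift-restrict ξ ξa≡ξb))

record Shrinking (P : FinPoset) (E : List (Pair P)) : Set where
  field
    shrunk       : FinPoset
    shrunk-size  : suc (size shrunk) ≡ size P
    constraints  : List (Pair shrunk)
    count-shrunk : ∀ Z → count P Z E [] ≡ count shrunk Z constraints []

merge-adjacent : {a b : Carrier P} → Adjacent P a b → ∀ E → Shrinking P (pair a b ∷ E)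
merge-adjacent {record { size = zero }} {zero} {zero} adj = contradiction refl (Adjacent.distinct adj)
merge-adjacent {record { size = suc k ; le = l ; refl = r ; antisym = an ; trans = t }} adj E = record
  { shrunk       = P/ab
  ; shrunk-size  = refl
  ; constraints  = map projectPair E
  ; count-shrunk = λ Z → count-merged Z E
  }
  where open Merging.Quotient l r an t adj

shrink : (P : FinPoset) {a b : Carrier P} → a ≢ b → ∀ E → Shrinking P (pair a b ∷ E)
shrink P a≢b E with a′ , b′ , adj , E′ , E≋E′ ← adjacent-reduction P a≢b E = record
  { shrunk       = shrunk
  ; shrunk-size  = shrunk-size
  ; constraints  = constraints
  ; count-shrunk = λ Z → trans (count-cong E≋E′ Z []) (count-shrunk Z)
  }
  where open Shrinking (merge-adjacent adj E′)

-- Hom-counts determine constrained counts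

all-pairs : (P : FinPoset) → List (Pair P)
all-pairs P = cartesianProductWith pair (allFin _) (allFin _)

distinct? : Decidable {A = Pair P} (λ e → fst e ≢ snd e)
distinct? e = ¬? (fst e Fin.≟ snd e)

distinct-pairs : (P : FinPoset) → List (Pair P)
distinct-pairs P = filter distinct? (all-pairs P)

∈-distinct-pairs : ∀ {x y : Carrier P} → x ≢ y → pair x y ∈ distinct-pairs P
∈-distinct-pairs {x = x} {y} x≢y =
  ∈-filter⁺ distinct? (∈-cartesianProductWith⁺ pair (∈-allFin x) (∈-allFin y)) x≢y

injective⇒separated : (ξ : Hom P X) → Injective _≡_ _≡_ (app ξ) → All (∁ (Identifies ξ)) (distinct-pairs P)
injective⇒separated ξ ξ-injective = All.tabulate λ e∈ → proj₂ (∈-filter⁻ distinct? {xs = all-pairs _} e∈) ∘ ξ-injective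

separated⇒injective : (ξ : Hom P X) → All (∁ (Identifies ξ)) (distinct-pairs P) → Injective _≡_ _≡_ (app ξ)
separated⇒injective ξ separated {x} {y} ξx≡ξy with x Fin.≟ y
... | yes x≡y = x≡y
... | no  x≢y = contradiction ξx≡ξy (All.lookup separated (∈-distinct-pairs x≢y))

module _ {X Y : FinPoset} (same-homs : ∀ P → length (homs P X) ≡ length (homs P Y)) where

  count-≡-identifying : ∀ n P → size P < n → ∀ E → count P X E [] ≡ count P Y E []
  count-≡-identifying zero    P ()
  count-≡-identifying (suc n) P P<n = count-P
    where
    count-P : ∀ E → count P X E [] ≡ count P Y E []
    count-P [] = trans (count-unconstrained P X) (trans (same-homs P) (sym (count-unconstrained P Y)))
    count-P (pair a b ∷ E) with a Fin.≟ b
    ... | yes refl =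
      trans (count-cong (identify-refl a E) X []) (trans (count-P E) (sym (count-cong (identify-refl a E) Y [])))
    ... | no a≢b =
      let open Shrinking (shrink P a≢b E)
      in trans (count-shrunk X)
           (trans (count-≡-identifying n shrunk (subst (_≤ n) (sym shrunk-size) (≤-pred P<n)) constraints)
             (sym (count-shrunk Y)))

  count-≡ : ∀ P E F → count P X E F ≡ count P Y E F
  count-≡ P E [] = count-≡-identifying (suc (size P)) P ≤-refl E
  count-≡ P E (e ∷ F) = +-cancelˡ-≡ (count P X (e ∷ E) F) _ _ (begin
    count P X (e ∷ E) F + count P X E (e ∷ F) ≡⟨ count-split e E F ⟨
    count P X E F                             ≡⟨ count-≡ P E F ⟩
    count P Y E F                             ≡⟨ count-split e E F ⟩
    count P Y (e ∷ E) F + count P Y E (e ∷ F) ≡⟨ cong (_+ _) (count-≡ P (e ∷ E) F) ⟨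
    count P X (e ∷ E) F + count P Y E (e ∷ F) ∎)
    where open ≡-Reasoning

  embedding-transfer : (ξ : Hom P X) → Injective _≡_ _≡_ (app ξ) → ∃ λ (η : Hom P Y) → Injective _≡_ _≡_ (app η)
  embedding-transfer {P} ξ ξ-injective =
    η , separated⇒injective η (Constrained.separated (proj₂ (∈-filter⁻ (constrained? [] F) {xs = homs P Y} η∈)))
    where
    F = distinct-pairs P
    ξ∈ : ξ ∈ filter (constrained? [] F) (homs P X)
    ξ∈ = ∈-filter⁺ (constrained? [] F) (∈-homs ξ) (constrained [] (injective⇒separated ξ ξ-injective))
    η-found : ∃ (_∈ filter (constrained? [] F) (homs P Y))
    η-found = 0<length⇒∈ (subst (0 <_) (count-≡ P [] F) (∈⇒0<length ξ∈))
    η = proj₁ η-found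
    η∈ = proj₂ η-found

-- Self-duality

antitone-injection⇒≃dual : (f : Carrier R → Carrier R) → Injective _≡_ _≡_ f → Monotone R (dual R) f → R ≃ dual R
antitone-injection⇒≃dual {R} f f-injective f-antitone = f , g , g∘f , f∘g , λ x y → mk⇔ f-antitone (f-reflects x y)
  where
  f-onto : ∀ y → ∃ λ x → x ∈ allFin _ × y ≡ f x
  f-onto y = ∈-map⁻ f (injection-onto Fin._≟_ (Unique.allFin⁺ _) f-injective (λ _ → ∈-allFin _) (∈-allFin y))

  g : Carrier R → Carrier R
  g y = proj₁ (f-onto y)

  f∘g : ∀ y → f (g y) ≡ y
  f∘g y = sym (proj₂ (proj₂ (f-onto y)))

  g∘f : ∀ x → g (f x) ≡ x
  g∘f x = f-injective (f∘g (f x))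

  ordered? : Decidable {A = Carrier R × Carrier R} (uncurry (R ⊢_≤_))
  ordered? (x , y) = T? (le R x y)

  ordered-pairs : List (Carrier R × Carrier R)
  ordered-pairs = filter ordered? (cartesianProduct (allFin _) (allFin _))

  reverse : Carrier R × Carrier R → Carrier R × Carrier R
  reverse (x , y) = f y , f x

  reverse-injective : Injective _≡_ _≡_ reverse
  reverse-injective {x , y} {x′ , y′} fy,fx≡fy′,fx′ =
    let fy≡fy′ , fx≡fx′ = Product.×-≡,≡←≡ fy,fx≡fy′,fx′
    in Product.×-≡,≡→≡ (f-injective fx≡fx′ , f-injective fy≡fy′)

  reverse-ordered : ∀ {e} → e ∈ ordered-pairs → reverse e ∈ ordered-pairs
  reverse-ordered {x , y} e∈ = ∈-filter⁺ ordered? (∈-cartesianProduct⁺ (∈-allFin (f y)) (∈-allFin (f x)))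
    (f-antitone (proj₂ (∈-filter⁻ ordered? {xs = cartesianProduct (allFin _) (allFin _)} e∈)))

  f-reflects : ∀ x y → R ⊢ f y ≤ f x → R ⊢ x ≤ y
  f-reflects x y fy≤fx
    with (u , v) , uv∈ , fy,fx≡fv,fu ← ∈-map⁻ reverse (injection-onto (Product.≡-dec Fin._≟_ Fin._≟_)
           (Unique.filter⁺ ordered? (Unique.cartesianProduct⁺ (Unique.allFin⁺ _) (Unique.allFin⁺ _)))
           reverse-injective reverse-ordered
           (∈-filter⁺ ordered? (∈-cartesianProduct⁺ (∈-allFin (f y)) (∈-allFin (f x))) fy≤fx))
    with refl ← reverse-injective {x , y} {u , v} fy,fx≡fv,fu
    = proj₂ (∈-filter⁻ ordered? {xs = cartesianProduct (allFin _) (allFin _)} uv∈)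

≃⇒⊑ : R ≃ S → R ⊑ S
≃⇒⊑ {R} {S} (f , g , g∘f , _ , f-iso) = ρ , ρ-strong
  where
  f-mono : Monotone R S f
  f-mono = to (f-iso _ _)

  ρ : HomScheme R S
  ρ P ξ = toHom (f ∘ app ξ) (f-mono ∘ app-mono ξ)

  f-injective : Injective _≡_ _≡_ f
  f-injective {x} {y} fx≡fy = trans (sym (g∘f x)) (trans (cong g fx≡fy) (g∘f y))

  ρ-strong : Strong ρ
  ρ-strong P {ξ} {η} ρξ≡ρη = hom-ext λ x → f-injective (begin
    f (app ξ x)       ≡⟨ app-toHom {P = P} {Q = S} (f ∘ app ξ) (f-mono ∘ app-mono ξ) x ⟨
    app (ρ P ξ) x     ≡⟨ cong (λ ζ → app ζ x) ρξ≡ρη ⟩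
    app (ρ P η) x     ≡⟨ app-toHom {P = P} {Q = S} (f ∘ app η) (f-mono ∘ app-mono η) x ⟩
    f (app η x)       ∎)
    where open ≡-Reasoning

⊑⇒homs-length-≤ : R ⊑ S → ∀ P → length (homs P R) ≤ length (homs P S)
⊑⇒homs-length-≤ {R} (ρ , ρ-strong) P =
  length-≤-injection {f = ρ P} (homs-unique P R) (ρ-strong P) (λ {ξ} _ → ∈-homs (ρ P ξ))

⊑dual⇒≃dual : R ⊑ dual R → R ≃ dual R
⊑dual⇒≃dual {R} R⊑Rᵈ = antitone-injection⇒≃dual {R = R} (app η) η-injective (app-mono η)
  where
  same-homs : ∀ P → length (homs P R) ≡ length (homs P (dual R))
  same-homs P = ≤-antisym (⊑⇒homs-length-≤ R⊑Rᵈ P) (⊑⇒homs-length-≤ (dual-⊑ R⊑Rᵈ) P)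

  identity : Hom R R
  identity = toHom id id

  identity-injective : Injective _≡_ _≡_ (app identity)
  identity-injective {x} {y} x≡y = trans (sym (app-identity x)) (trans x≡y (app-identity y))
    where
    app-identity : ∀ x → app identity x ≡ x
    app-identity = app-toHom {P = R} {Q = R} id id

  anti-embedding : ∃ λ (η : Hom R (dual R)) → Injective _≡_ _≡_ (app η)
  anti-embedding = embedding-transfer same-homs identity identity-injective

  η = proj₁ anti-embedding
  η-injective = proj₂ anti-embedding

proposition2 : (R S : FinPoset) →
    ((R ⊑ S) ⇔ (dual R ⊑ dual S)) ×
    ((R ⊑G S) ⇔ (dual R ⊑G dual S)) ×
    ((R ⊑I S) ⇔ (dual R ⊑I dual S)) ×
    ((R ⊑ dual R) ⇔ (R ≃ dual R))
proposition2 R S =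
  mk⇔ dual-⊑ dual-⊑ ,
  mk⇔ dual-⊑G dual-⊑G ,
  mk⇔ dual-⊑I dual-⊑I ,
  mk⇔ ⊑dual⇒≃dual ≃⇒⊑
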